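{- Let $n$ and $k$ be positive integers and $1\le r\le \lfloor n/2\rfloor$. Let $\sigma\in\mathfrak{S}_n$ be an involution with cycle decomposition $\sigma=(a_1\,b_1)(a_2\,b_2)\cdots(a_r\,b_r)$ (all other points fixed), where $a_1,\dots,a_r,b_1,\dots,b_r$ are pairwise distinct. Then the number of fixed points of $\sigma^{\odot k}$ is $$\operatorname{Fix}(\sigma^{\odot k})=\sum_{\ell=0}^{\lfloor k/2\rfloor}\binom{\ell+r-1}{\ell}\binom{k-2\ell+n-2r-1}{k-2\ell}.$$
   Context: For positive integers $n,k$, let $\mathcal{C}_{n,k}$ be the set of weakly increasing $k$-tuples $(i_1\le\cdots\le i_k)$ with entries in $[n]=\{1,\dots,n\}$ (equivalently, $k$-element multisets from $[n]$). For $\sigma\in\mathfrak{S}_n$, the $k$-th symmetric tensor power $\sigma^{\odot k}$ is the permutation of $\mathcal{C}_{n,k}$ sending $(i_1,\dots,i_k)$ to the weakly increasing rearrangement of $(\sigma(i_1),\dots,\sigma(i_k))$ (equivalently, the permutation given by the $k$-th symmetric tensor power of the permutation matrix of $\sigma$). $\operatorname{Fix}(\tau)$ is the number of fixed points of a permutation $\tau$. Binomial coefficients $\binom{a}{b}$ with integer $a$ and nonnegative integer $b$ are $a(a-1)\cdots(a-b+1)/b!$ (so e.g. $\binom{ -1}{0}=1$ and $\binom{m-1}{m}=0$ for $m\ge1$). -}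

module Defs where

open import Data.Nat as ℕ using (ℕ; zero; suc; _≤_; _!; _≤ᵇ_)
open import Data.Nat.Properties using (_!≢0)
open import Data.Integer as ℤ using (ℤ; +_; _-_; _*_)
open import Data.Integer.DivMod using (_/ℕ_)
open import Data.Fin using (Fin; toℕ)
open import Data.Fin.Properties using (_≟_)
open import Data.Vec using (Vec; []; _∷_; map)
open import Data.Vec.Properties using (≡-dec)
open import Data.List as List using (List; []; _∷_; concatMap; allFin; length; filter)
open import Data.Bool using (Bool; true; false; _∧_; T)
open import Relation.Nullary using (Dec; yes; no)
open import Relation.Nullary.Decidable using (_×-dec_; T?)
open import Relation.Binary.PropositionalEquality using (_≡_)
open import Data.Fin.Permutation using (Permutation′; _⟨$⟩ʳ_)

fallingℤ : ℤ → ℕ → ℤ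
fallingℤ a zero    = + 1
fallingℤ a (suc b) = fallingℤ a b * (a - + b)

binomℤ : ℤ → ℕ → ℤ
binomℤ a b = (fallingℤ a b /ℕ (b !)) {{b !≢0}}

allTuples : (n k : ℕ) → List (Vec (Fin n) k)
allTuples n zero    = [] ∷ []
allTuples n (suc k) = concatMap (λ i → List.map (i ∷_) (allTuples n k)) (allFin n)

increasingᵇ : ∀ {n k} → Vec (Fin n) k → Bool
increasingᵇ []            = true
increasingᵇ (x ∷ [])      = true
increasingᵇ (x ∷ y ∷ xs)  = (toℕ x ≤ᵇ toℕ y) ∧ increasingᵇ (y ∷ xs)

C : (n k : ℕ) → List (Vec (Fin n) k)
C n k = filter (λ v → T? (increasingᵇ v)) (allTuples n k)

insert : ∀ {n k} → Fin n → Vec (Fin n) k → Vec (Fin n) (suc k)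
insert x []       = x ∷ []
insert x (y ∷ ys) with toℕ x ≤ᵇ toℕ y
... | true  = x ∷ y ∷ ys
... | false = y ∷ insert x ys

sort : ∀ {n k} → Vec (Fin n) k → Vec (Fin n) k
sort []       = []
sort (x ∷ xs) = insert x (sort xs)

-- k-th symmetric tensor power of σ acting on C_{n,k}
symPow : ∀ {n} (k : ℕ) → Permutation′ n → Vec (Fin n) k → Vec (Fin n) k
symPow k σ c = sort (map (σ ⟨$⟩ʳ_) c)

FixSymPow : ∀ {n} (k : ℕ) → Permutation′ n → ℕ
FixSymPow {n} k σ = length (filter (λ c → ≡-dec _≟_ (symPow k σ c) c) (C n k))

sumTo : ℕ → (ℕ → ℤ) → ℤ
sumTo zero    f = f 0
sumTo (suc m) f = sumTo m f ℤ.+ f (suc m)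

module Submission where

-- A weakly increasing tuple is determined by its multiplicity vector m : [n] → ℕ with Σ m = k,
-- and σ^{⊙k} fixes it exactly when m ∘ σ = m, i.e. when m (a i) = m (b i) for every transposition
-- (a i  b i). Writing ℓ for the sum of m over a 1, …, a r, there are C(ℓ+r−1, ℓ) choices of m on
-- the pairs and C(k−2ℓ+n−2r−1, k−2ℓ) choices on the n − 2r fixed points, which carry the remaining
-- k − 2ℓ. Both the passage from sorted tuples to multiplicity vectors and the count of balanced
-- vectors go through Pascal-type recurrences, splitting off one point or one pair at a time.

open import Defs
open import Data.Nat using (ℕ; _≤_; _/_; _∸_; _*_)
open import Data.Integer as ℤ using (ℤ; +_; _-_)
open import Data.Fin using (Fin)
open import Data.Sum using (_⊎_; [_,_])
open import Data.Product using (_×_)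
open import Function.Definitions using (Injective)
open import Relation.Binary.PropositionalEquality using (_≡_; _≢_)
open import Data.Fin.Permutation using (Permutation′; _⟨$⟩ʳ_)

open import Data.Bool using (Bool; true; false; _∧_; if_then_else_; T)
open import Data.Bool.Properties using (∧-zeroʳ; T-∧; T-≡)
open import Data.Empty using (⊥-elim)
open import Data.Fin as Fin using (toℕ)
import Data.Fin.Properties as Fin
open import Data.Fin.Permutation using (_⟨$⟩ˡ_; inverseˡ; inverseʳ)
import Data.Integer.Properties as ℤ
open import Data.List as List using (List; []; _∷_; _++_; length; filter; concatMap)
open import Data.Nat using (zero; suc; _+_; _≤ᵇ_; _<_; z≤n; s≤s; _!)
import Data.Nat.Properties as ℕ
open import Algebra.Properties.CommutativeSemigroup ℕ.+-commutativeSemigroup using (interchange; xy∙z≈xz∙y)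
open import Algebra.Properties.Monoid.Sum ℕ.+-0-monoid using (sum; sum-cong-≗)
open import Data.Nat.Combinatorics using (_P_; nCk≡nPk/k!; k>n⇒nCk≡0; nCn≡1; nCk+nC[k+1]≡[n+1]C[k+1])
  renaming (_C_ to _choose_)
open import Data.Nat.Combinatorics.Base using (_P′_)
open import Data.Nat.DivMod using (m/n≡1+[m∸n]/n; 0/n≡0; m/n*n≤m)
open import Data.Product using (_,_; proj₂)
open import Data.Sum as Sum using (inj₁; inj₂)
open import Data.Sum.Properties using (inj₁-injective; inj₂-injective)
open import Data.Unit using (tt)
open import Data.Vec as Vec using (Vec; []; _∷_)
open import Data.Vec.Properties using (≡-dec; lookup-replicate; lookup∘updateAt; lookup∘updateAt′;
  updateAt-commutes; ∷-injectiveˡ; ∷-injectiveʳ; tabulate∘lookup; tabulate-cong; insertAt-lookup; insertAt-punchIn)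
open import Function.Base using (_∘_)
open import Function.Bundles using (Equivalence; _⇔_; mk⇔)
import Function.Properties.Equivalence as ⇔
open import Relation.Binary.Definitions using (tri<; tri≈; tri>)
open import Relation.Binary.PropositionalEquality using (refl; sym; trans; cong; cong₂; subst; module ≡-Reasoning)
open import Relation.Nullary using (Dec; does; yes; no)
open import Relation.Nullary.Decidable using (does-⇔; T?; _×-dec_)
open import Relation.Unary using (Pred; Decidable)

private variable
  A B : Set

suc-≤ᵇ-suc : ∀ m n → (suc m ≤ᵇ suc n) ≡ (m ≤ᵇ n)
suc-≤ᵇ-suc zero    n = refl
suc-≤ᵇ-suc (suc m) n = refl

∧-absorb : ∀ {a b} c → (T a → T b) → a ∧ c ≡ b ∧ (a ∧ c)
∧-absorb {false} {b}     c _   = sym (∧-zeroʳ b)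
∧-absorb {true}  {true}  c _   = refl
∧-absorb {true}  {false} c a⇒b = ⊥-elim (a⇒b tt)

∧-congˡ-T : ∀ {a b c} → (T a → b ≡ c) → a ∧ b ≡ a ∧ c
∧-congˡ-T {false} _   = refl
∧-congˡ-T {true}  b≡c = b≡c tt

count : (A → Bool) → List A → ℕ
count p []       = 0
count p (x ∷ xs) = if p x then suc (count p xs) else count p xs

count-cong : ∀ {p q : A → Bool} → (∀ x → p x ≡ q x) → ∀ xs → count p xs ≡ count q xs
count-cong p≗q []       = refl
count-cong p≗q (x ∷ xs) = cong₂ (λ b c → if b then suc c else c) (p≗q x) (count-cong p≗q xs)

count-false : ∀ (xs : List A) → count (λ _ → false) xs ≡ 0
count-false []       = refl
count-false (x ∷ xs) = count-false xs

count-++ : ∀ (p : A → Bool) xs ys → count p (xs ++ ys) ≡ count p xs + count p ys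
count-++ p []       ys = refl
count-++ p (x ∷ xs) ys with p x
... | true  = cong suc (count-++ p xs ys)
... | false = count-++ p xs ys

count-map : ∀ (p : B → Bool) (f : A → B) xs → count p (List.map f xs) ≡ count (λ x → p (f x)) xs
count-map p f []       = refl
count-map p f (x ∷ xs) = cong (λ c → if p (f x) then suc c else c) (count-map p f xs)

count-concatMap-tabulate : ∀ {n} (p : B → Bool) (h : A → List B) (g : Fin n → A) →
  count p (concatMap h (List.tabulate g)) ≡ sum (λ i → count p (h (g i)))
count-concatMap-tabulate {n = zero}  p h g = refl
count-concatMap-tabulate {n = suc n} p h g = trans (count-++ p (h (g Fin.zero)) _)
  (cong (λ c → count p (h (g Fin.zero)) + c) (count-concatMap-tabulate p h (λ i → g (Fin.suc i))))

length-filter : ∀ {ℓ} {P : Pred A ℓ} (P? : Decidable P) xs →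
  length (filter P? xs) ≡ count (λ x → does (P? x)) xs
length-filter P? []       = refl
length-filter P? (x ∷ xs) with does (P? x)
... | true  = cong suc (length-filter P? xs)
... | false = length-filter P? xs

count-filter : ∀ {ℓ} {P : Pred A ℓ} (P? : Decidable P) (p : A → Bool) xs →
  count p (filter P? xs) ≡ count (λ x → does (P? x) ∧ p x) xs
count-filter P? p []       = refl
count-filter P? p (x ∷ xs) with does (P? x)
... | true  = cong (λ c → if p x then suc c else c) (count-filter P? p xs)
... | false = count-filter P? p xs

countTuples : ∀ n k → (Vec (Fin n) k → Bool) → ℕ
countTuples n k p = count p (allTuples n k)

countTuples-cong : ∀ n k {p q : Vec (Fin n) k → Bool} → (∀ v → p v ≡ q v) →
  countTuples n k p ≡ countTuples n k q
countTuples-cong n k p≗q = count-cong p≗q (allTuples n k)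

countTuples-suc : ∀ n k p →
  countTuples n (suc k) p ≡ sum (λ i → countTuples n k (λ v → p (i ∷ v)))
countTuples-suc n k p = trans (count-concatMap-tabulate p (λ i → List.map (i ∷_) (allTuples n k)) (λ i → i))
  (sum-cong-≗ (λ i → count-map p (i ∷_) (allTuples n k)))

avoidsZeroᵇ : ∀ {n k} → Vec (Fin (suc n)) k → Bool
avoidsZeroᵇ []               = true
avoidsZeroᵇ (Fin.zero  ∷ _)  = false
avoidsZeroᵇ (Fin.suc _ ∷ v)  = avoidsZeroᵇ v

countTuples-avoidsZero : ∀ n k p →
  countTuples (suc n) k (λ v → avoidsZeroᵇ v ∧ p v) ≡ countTuples n k (λ w → p (Vec.map Fin.suc w))
countTuples-avoidsZero n zero    p = refl
countTuples-avoidsZero n (suc k) p = begin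
  countTuples (suc n) (suc k) (λ v → avoidsZeroᵇ v ∧ p v)
    ≡⟨ countTuples-suc (suc n) k _ ⟩
  countTuples (suc n) k (λ _ → false) + sum (λ i → countTuples (suc n) k (λ v → avoidsZeroᵇ v ∧ p (Fin.suc i ∷ v)))
    ≡⟨ cong₂ _+_ (count-false (allTuples (suc n) k))
                 (sum-cong-≗ (λ i → countTuples-avoidsZero n k (λ v → p (Fin.suc i ∷ v)))) ⟩
  sum (λ i → countTuples n k (λ w → p (Vec.map Fin.suc (i ∷ w))))
    ≡⟨ countTuples-suc n k _ ⟨
  countTuples n (suc k) (λ w → p (Vec.map Fin.suc w)) ∎
  where open ≡-Reasoning

increasing-zero∷ : ∀ {n k} (v : Vec (Fin (suc n)) k) → increasingᵇ (Fin.zero ∷ v) ≡ increasingᵇ v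
increasing-zero∷ []      = refl
increasing-zero∷ (_ ∷ _) = refl

increasing-map-suc : ∀ {n k} (v : Vec (Fin n) k) → increasingᵇ (Vec.map Fin.suc v) ≡ increasingᵇ v
increasing-map-suc []          = refl
increasing-map-suc (_ ∷ [])    = refl
increasing-map-suc (x ∷ y ∷ v) = cong₂ _∧_ (suc-≤ᵇ-suc (toℕ x) (toℕ y)) (increasing-map-suc (y ∷ v))

increasing-suc∷⇒avoidsZero : ∀ {n k} (x : Fin n) (v : Vec (Fin (suc n)) k) →
  T (increasingᵇ (Fin.suc x ∷ v)) → T (avoidsZeroᵇ v)
increasing-suc∷⇒avoidsZero x []               _ = tt
increasing-suc∷⇒avoidsZero x (Fin.suc y ∷ v) h = increasing-suc∷⇒avoidsZero y v (proj₂ (Equivalence.to T-∧ h))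

countSorted-split : ∀ n k (p : Vec (Fin (suc n)) (suc k) → Bool) →
  countTuples (suc n) (suc k) (λ v → increasingᵇ v ∧ p v) ≡
  countTuples (suc n) k (λ v → increasingᵇ v ∧ p (Fin.zero ∷ v)) +
  countTuples n (suc k) (λ w → increasingᵇ w ∧ p (Vec.map Fin.suc w))
countSorted-split n k p = begin
  countTuples (suc n) (suc k) (λ v → increasingᵇ v ∧ p v)
    ≡⟨ countTuples-suc (suc n) k _ ⟩
  countTuples (suc n) k (λ v → increasingᵇ (Fin.zero ∷ v) ∧ p (Fin.zero ∷ v)) + sum sucFirst
    ≡⟨ cong₂ _+_ (countTuples-cong (suc n) k (λ v → cong (_∧ p (Fin.zero ∷ v)) (increasing-zero∷ v)))
                 (sum-cong-≗ sucFirst≡) ⟩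
  countTuples (suc n) k (λ v → increasingᵇ v ∧ p (Fin.zero ∷ v)) +
  sum (λ i → countTuples n k (λ w → increasingᵇ (i ∷ w) ∧ p (Vec.map Fin.suc (i ∷ w))))
    ≡⟨ cong (λ c → countTuples (suc n) k (λ v → increasingᵇ v ∧ p (Fin.zero ∷ v)) + c) (countTuples-suc n k _) ⟨
  countTuples (suc n) k (λ v → increasingᵇ v ∧ p (Fin.zero ∷ v)) +
  countTuples n (suc k) (λ w → increasingᵇ w ∧ p (Vec.map Fin.suc w)) ∎
  where
  open ≡-Reasoning
  sucFirst : Fin n → ℕ
  sucFirst i = countTuples (suc n) k (λ v → increasingᵇ (Fin.suc i ∷ v) ∧ p (Fin.suc i ∷ v))
  sucFirst≡ : ∀ i → sucFirst i ≡ countTuples n k (λ w → increasingᵇ (i ∷ w) ∧ p (Vec.map Fin.suc (i ∷ w)))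
  sucFirst≡ i = begin
    sucFirst i
      ≡⟨ countTuples-cong (suc n) k (λ v → ∧-absorb _ (increasing-suc∷⇒avoidsZero i v)) ⟩
    countTuples (suc n) k (λ v → avoidsZeroᵇ v ∧ (increasingᵇ (Fin.suc i ∷ v) ∧ p (Fin.suc i ∷ v)))
      ≡⟨ countTuples-avoidsZero n k _ ⟩
    countTuples n k (λ w → increasingᵇ (Vec.map Fin.suc (i ∷ w)) ∧ p (Vec.map Fin.suc (i ∷ w)))
      ≡⟨ countTuples-cong n k (λ w → cong (_∧ p (Vec.map Fin.suc (i ∷ w))) (increasing-map-suc (i ∷ w))) ⟩
    countTuples n k (λ w → increasingᵇ (i ∷ w) ∧ p (Vec.map Fin.suc (i ∷ w))) ∎

Σ≤ : ℕ → (ℕ → ℕ) → ℕ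
Σ≤ zero    g = g 0
Σ≤ (suc k) g = g 0 + Σ≤ k (λ j → g (suc j))

Σ≤-cong : ∀ k {g h : ℕ → ℕ} → (∀ j → j ≤ k → g j ≡ h j) → Σ≤ k g ≡ Σ≤ k h
Σ≤-cong zero    g≗h = g≗h 0 z≤n
Σ≤-cong (suc k) g≗h = cong₂ _+_ (g≗h 0 z≤n) (Σ≤-cong k (λ j j≤k → g≗h (suc j) (s≤s j≤k)))

Σ≤-zero : ∀ k → Σ≤ k (λ _ → 0) ≡ 0
Σ≤-zero zero    = refl
Σ≤-zero (suc k) = Σ≤-zero k

Σ≤-+ : ∀ k (g h : ℕ → ℕ) → Σ≤ k (λ j → g j + h j) ≡ Σ≤ k g + Σ≤ k h
Σ≤-+ zero    g h = refl
Σ≤-+ (suc k) g h = trans (cong (λ s → g 0 + h 0 + s) (Σ≤-+ k (λ j → g (suc j)) (λ j → h (suc j))))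
  (interchange (g 0) (h 0) _ _)

Σ≤-snoc : ∀ k (g : ℕ → ℕ) → Σ≤ (suc k) g ≡ Σ≤ k g + g (suc k)
Σ≤-snoc zero    g = refl
Σ≤-snoc (suc k) g = trans (cong (λ s → g 0 + s) (Σ≤-snoc k (λ j → g (suc j)))) (sym (ℕ.+-assoc (g 0) _ _))

Σ≤-select : ∀ k j (g : ℕ → ℕ) →
  Σ≤ k (λ j′ → if does (j ℕ.≟ j′) then g j′ else 0) ≡ (if j ≤ᵇ k then g j else 0)
Σ≤-select zero    zero    g = refl
Σ≤-select zero    (suc j) g = refl
Σ≤-select (suc k) zero    g = trans (cong (λ s → g 0 + s) (Σ≤-zero k)) (ℕ.+-identityʳ (g 0))
Σ≤-select (suc k) (suc j) g =
  trans (Σ≤-select k j (λ j′ → g (suc j′))) (cong (λ b → if b then g (suc j) else 0) (sym (suc-≤ᵇ-suc j k)))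

Σ≤-triangle-peel : ∀ k (h : ℕ → ℕ → ℕ) →
  Σ≤ (suc k) (λ a → Σ≤ (suc k ∸ a) (h a)) ≡
  Σ≤ (suc k) (λ a → h a 0) + Σ≤ k (λ a → Σ≤ (k ∸ a) (λ b → h a (suc b)))
Σ≤-triangle-peel zero    h = xy∙z≈xz∙y (h 0 0) (h 0 1) (h 1 0)
Σ≤-triangle-peel (suc k) h =
  trans (cong (λ s → Σ≤ (suc (suc k)) (h 0) + s) (Σ≤-triangle-peel k (λ a → h (suc a))))
        (interchange (h 0 0) (Σ≤ (suc k) (λ b → h 0 (suc b))) (Σ≤ (suc k) (λ a → h (suc a) 0)) _)

Σ≤-triangle-swap : ∀ k (h : ℕ → ℕ → ℕ) →
  Σ≤ k (λ a → Σ≤ (k ∸ a) (h a)) ≡ Σ≤ k (λ b → Σ≤ (k ∸ b) (λ a → h a b))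
Σ≤-triangle-swap zero    h = refl
Σ≤-triangle-swap (suc k) h =
  trans (cong (λ s → Σ≤ (suc k) (h 0) + s) (Σ≤-triangle-swap k (λ a → h (suc a))))
        (sym (Σ≤-triangle-peel k (λ b a → h a b)))

∸-∸-comm : ∀ k i j → k ∸ i ∸ j ≡ k ∸ j ∸ i
∸-∸-comm k i j = trans (ℕ.∸-+-assoc k i j) (trans (cong (k ∸_) (ℕ.+-comm i j)) (sym (ℕ.∸-+-assoc k j i)))

countCompositions : (n k : ℕ) → (Vec ℕ n → Bool) → ℕ
countCompositions zero    zero    p = if p [] then 1 else 0
countCompositions zero    (suc k) p = 0
countCompositions (suc n) k       p = Σ≤ k (λ j → countCompositions n (k ∸ j) (λ m → p (j ∷ m)))

countCompositions-zero : ∀ n p → countCompositions n 0 p ≡ (if p (Vec.replicate n 0) then 1 else 0)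
countCompositions-zero zero    p = refl
countCompositions-zero (suc n) p = countCompositions-zero n (λ m → p (0 ∷ m))

countCompositions-pascal : ∀ n k p → countCompositions (suc n) (suc k) p ≡
  countCompositions n (suc k) (λ m → p (0 ∷ m)) + countCompositions (suc n) k (λ m → p (Vec.updateAt m Fin.zero suc))
countCompositions-pascal n k p = refl

countCompositions-cong : ∀ n k {p q : Vec ℕ n → Bool} → (∀ m → p m ≡ q m) →
  countCompositions n k p ≡ countCompositions n k q
countCompositions-cong zero    zero    p≗q = cong (λ b → if b then 1 else 0) (p≗q [])
countCompositions-cong zero    (suc k) p≗q = refl
countCompositions-cong (suc n) k       p≗q =
  Σ≤-cong k (λ j _ → countCompositions-cong n (k ∸ j) (λ m → p≗q (j ∷ m)))

countCompositions-false : ∀ n k → countCompositions n k (λ _ → false) ≡ 0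
countCompositions-false zero    zero    = refl
countCompositions-false zero    (suc k) = refl
countCompositions-false (suc n) k       =
  trans (Σ≤-cong k (λ j _ → countCompositions-false n (k ∸ j))) (Σ≤-zero k)

countCompositions-∧ : ∀ n k b (p : Vec ℕ n → Bool) →
  countCompositions n k (λ m → b ∧ p m) ≡ (if b then countCompositions n k p else 0)
countCompositions-∧ n k true  p = refl
countCompositions-∧ n k false p = countCompositions-false n k

countCompositions-insertAt : ∀ n k (p : Vec ℕ (suc n) → Bool) (i : Fin (suc n)) →
  countCompositions (suc n) k p ≡ Σ≤ k (λ j → countCompositions n (k ∸ j) (λ m → p (Vec.insertAt m i j)))
countCompositions-insertAt n       k p Fin.zero    = refl
countCompositions-insertAt (suc n) k p (Fin.suc i) = begin
  Σ≤ k (λ j₀ → countCompositions (suc n) (k ∸ j₀) (λ m → p (j₀ ∷ m)))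
    ≡⟨ Σ≤-cong k (λ j₀ _ → countCompositions-insertAt n (k ∸ j₀) (λ m → p (j₀ ∷ m)) i) ⟩
  Σ≤ k (λ j₀ → Σ≤ (k ∸ j₀) (λ j → inner (k ∸ j₀ ∸ j) j₀ j))
    ≡⟨ Σ≤-triangle-swap k (λ j₀ j → inner (k ∸ j₀ ∸ j) j₀ j) ⟩
  Σ≤ k (λ j → Σ≤ (k ∸ j) (λ j₀ → inner (k ∸ j₀ ∸ j) j₀ j))
    ≡⟨ Σ≤-cong k (λ j _ → Σ≤-cong (k ∸ j) (λ j₀ _ → cong (λ l → inner l j₀ j) (∸-∸-comm k j₀ j))) ⟩
  Σ≤ k (λ j → Σ≤ (k ∸ j) (λ j₀ → inner (k ∸ j ∸ j₀) j₀ j)) ∎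
  where
  open ≡-Reasoning
  inner : ℕ → ℕ → ℕ → ℕ
  inner l j₀ j = countCompositions n l (λ m → p (j₀ ∷ Vec.insertAt m i j))

multiplicities : ∀ {n k} → Vec (Fin n) k → Vec ℕ n
multiplicities []      = Vec.replicate _ 0
multiplicities (x ∷ v) = Vec.updateAt (multiplicities v) x suc

multiplicities-map-suc : ∀ {n k} (v : Vec (Fin n) k) → multiplicities (Vec.map Fin.suc v) ≡ 0 ∷ multiplicities v
multiplicities-map-suc []      = refl
multiplicities-map-suc (x ∷ v) = cong (λ m → Vec.updateAt m (Fin.suc x) suc) (multiplicities-map-suc v)

countSorted≡countCompositions : ∀ n k (p : Vec ℕ n → Bool) →
  countTuples n k (λ v → increasingᵇ v ∧ p (multiplicities v)) ≡ countCompositions n k p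
countSorted≡countCompositions n       zero    p = sym (countCompositions-zero n p)
countSorted≡countCompositions zero    (suc k) p = refl
countSorted≡countCompositions (suc n) (suc k) p = begin
  countTuples (suc n) (suc k) (λ v → increasingᵇ v ∧ p (multiplicities v))
    ≡⟨ countSorted-split n k _ ⟩
  countTuples (suc n) k (λ v → increasingᵇ v ∧ p (Vec.updateAt (multiplicities v) Fin.zero suc)) +
  countTuples n (suc k) (λ w → increasingᵇ w ∧ p (multiplicities (Vec.map Fin.suc w)))
    ≡⟨ cong₂ _+_ (countSorted≡countCompositions (suc n) k (λ m → p (Vec.updateAt m Fin.zero suc)))
                 (trans (countTuples-cong n (suc k) (λ w → cong (λ m → increasingᵇ w ∧ p m) (multiplicities-map-suc w)))
                        (countSorted≡countCompositions n (suc k) _)) ⟩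
  countCompositions (suc n) k (λ m → p (Vec.updateAt m Fin.zero suc)) + countCompositions n (suc k) (λ m → p (0 ∷ m))
    ≡⟨ ℕ.+-comm (countCompositions (suc n) k (λ m → p (Vec.updateAt m Fin.zero suc))) _ ⟩
  countCompositions n (suc k) (λ m → p (0 ∷ m)) + countCompositions (suc n) k (λ m → p (Vec.updateAt m Fin.zero suc))
    ≡⟨ countCompositions-pascal n k p ⟨
  countCompositions (suc n) (suc k) p ∎
  where open ≡-Reasoning

lookup-extensionality : ∀ {n} {xs ys : Vec A n} → (∀ i → Vec.lookup xs i ≡ Vec.lookup ys i) → xs ≡ ys
lookup-extensionality {xs = xs} {ys} xs≗ys =
  trans (sym (tabulate∘lookup xs)) (trans (tabulate-cong xs≗ys) (tabulate∘lookup ys))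

updateAt-suc-comm : ∀ {n} (i j : Fin n) (m : Vec ℕ n) →
  Vec.updateAt (Vec.updateAt m j suc) i suc ≡ Vec.updateAt (Vec.updateAt m i suc) j suc
updateAt-suc-comm i j m with i Fin.≟ j
... | yes refl = refl
... | no i≢j   = updateAt-commutes i j i≢j m

updateAt-suc-injective : ∀ {n} (i : Fin n) {m m′ : Vec ℕ n} →
  Vec.updateAt m i suc ≡ Vec.updateAt m′ i suc → m ≡ m′
updateAt-suc-injective Fin.zero    {_ ∷ _} {_ ∷ _} e =
  cong₂ _∷_ (ℕ.suc-injective (∷-injectiveˡ e)) (∷-injectiveʳ e)
updateAt-suc-injective (Fin.suc i) {_ ∷ _} {_ ∷ _} e =
  cong₂ _∷_ (∷-injectiveˡ e) (updateAt-suc-injective i (∷-injectiveʳ e))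

multiplicities-insert : ∀ {n k} (x : Fin n) (v : Vec (Fin n) k) →
  multiplicities (insert x v) ≡ Vec.updateAt (multiplicities v) x suc
multiplicities-insert x []      = refl
multiplicities-insert x (y ∷ v) with toℕ x ≤ᵇ toℕ y
... | true  = refl
... | false = trans (cong (λ m → Vec.updateAt m y suc) (multiplicities-insert x v))
                    (updateAt-suc-comm y x (multiplicities v))

multiplicities-sort : ∀ {n k} (v : Vec (Fin n) k) → multiplicities (sort v) ≡ multiplicities v
multiplicities-sort []      = refl
multiplicities-sort (x ∷ v) =
  trans (multiplicities-insert x (sort v)) (cong (λ m → Vec.updateAt m x suc) (multiplicities-sort v))

lookup-multiplicities-map : ∀ {n n′ k} (f : Fin n → Fin n′) → Injective _≡_ _≡_ f →
  ∀ (v : Vec (Fin n) k) x → Vec.lookup (multiplicities (Vec.map f v)) (f x) ≡ Vec.lookup (multiplicities v) x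
lookup-multiplicities-map f f-inj []      x = trans (lookup-replicate (f x) 0) (sym (lookup-replicate x 0))
lookup-multiplicities-map f f-inj (y ∷ v) x with y Fin.≟ x
... | yes refl = trans (lookup∘updateAt (f y) (multiplicities (Vec.map f v)))
  (trans (cong suc (lookup-multiplicities-map f f-inj v y)) (sym (lookup∘updateAt y (multiplicities v))))
... | no y≢x   =
  trans (lookup∘updateAt′ (f x) (f y) (λ fx≡fy → y≢x (f-inj (sym fx≡fy))) (multiplicities (Vec.map f v)))
  (trans (lookup-multiplicities-map f f-inj v x)
         (sym (lookup∘updateAt′ x y (λ x≡y → y≢x (sym x≡y)) (multiplicities v))))

increasing-∷⁻ : ∀ {n k} (x y : Fin n) (v : Vec (Fin n) k) →
  T (increasingᵇ (x ∷ y ∷ v)) → toℕ x ≤ toℕ y × T (increasingᵇ (y ∷ v))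
increasing-∷⁻ x y v h = let x≤ᵇy , hy = Equivalence.to T-∧ h in ℕ.≤ᵇ⇒≤ (toℕ x) (toℕ y) x≤ᵇy , hy

increasing-∷⁺ : ∀ {n k} (x y : Fin n) (v : Vec (Fin n) k) →
  toℕ x ≤ toℕ y → T (increasingᵇ (y ∷ v)) → T (increasingᵇ (x ∷ y ∷ v))
increasing-∷⁺ x y v x≤y hy = Equivalence.from T-∧ (ℕ.≤⇒≤ᵇ x≤y , hy)

increasing-tail : ∀ {n k} (x : Fin n) (v : Vec (Fin n) k) → T (increasingᵇ (x ∷ v)) → T (increasingᵇ v)
increasing-tail x []      _ = tt
increasing-tail x (y ∷ v) h = proj₂ (increasing-∷⁻ x y v h)

∷-insert-increasing : ∀ {n k} (y x : Fin n) (v : Vec (Fin n) k) →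
  toℕ y ≤ toℕ x → T (increasingᵇ (y ∷ v)) → T (increasingᵇ (y ∷ insert x v))
∷-insert-increasing y x []      y≤x _ = increasing-∷⁺ y x [] y≤x tt
∷-insert-increasing y x (z ∷ v) y≤x h with toℕ x ≤ᵇ toℕ z in x≤ᵇz
... | true  = increasing-∷⁺ y x (z ∷ v) y≤x
  (increasing-∷⁺ x z v (ℕ.≤ᵇ⇒≤ (toℕ x) (toℕ z) (Equivalence.from T-≡ x≤ᵇz)) (increasing-tail y (z ∷ v) h))
... | false = let y≤z , hz = increasing-∷⁻ y z v h in increasing-∷⁺ y z (insert x v) y≤z
  (∷-insert-increasing z x v (ℕ.≰⇒≥ (λ x≤z → subst T x≤ᵇz (ℕ.≤⇒≤ᵇ x≤z))) hz)

insert-increasing : ∀ {n k} x (v : Vec (Fin n) k) → T (increasingᵇ v) → T (increasingᵇ (insert x v))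
insert-increasing x []      _ = tt
insert-increasing x (y ∷ v) h with toℕ x ≤ᵇ toℕ y in x≤ᵇy
... | true  = increasing-∷⁺ x y v (ℕ.≤ᵇ⇒≤ (toℕ x) (toℕ y) (Equivalence.from T-≡ x≤ᵇy)) h
... | false = ∷-insert-increasing y x v (ℕ.≰⇒≥ (λ x≤y → subst T x≤ᵇy (ℕ.≤⇒≤ᵇ x≤y))) h

sort-increasing : ∀ {n k} (v : Vec (Fin n) k) → T (increasingᵇ (sort v))
sort-increasing []      = tt
sort-increasing (x ∷ v) = insert-increasing x (sort v) (sort-increasing v)

multiplicity-below-head : ∀ {n k} {x y : Fin n} (w : Vec (Fin n) k) →
  T (increasingᵇ (y ∷ w)) → toℕ x < toℕ y → Vec.lookup (multiplicities (y ∷ w)) x ≡ 0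
multiplicity-below-head {x = x} {y} w h x<y =
  trans (lookup∘updateAt′ x y (λ x≡y → ℕ.<-irrefl (cong toℕ x≡y) x<y) (multiplicities w)) (below w h)
  where
  below : ∀ {k} (w : Vec (Fin _) k) → T (increasingᵇ (y ∷ w)) → Vec.lookup (multiplicities w) x ≡ 0
  below []      _ = lookup-replicate x 0
  below (z ∷ w) h = let y≤z , hz = increasing-∷⁻ y z w h in
    multiplicity-below-head w hz (ℕ.<-≤-trans x<y y≤z)

sorted-multiplicities-injective : ∀ {n k} (u v : Vec (Fin n) k) → T (increasingᵇ u) → T (increasingᵇ v) →
  multiplicities u ≡ multiplicities v → u ≡ v
sorted-multiplicities-injective []      []      _  _  _ = refl
sorted-multiplicities-injective (x ∷ u) (y ∷ v) hu hv mu≡mv with Fin.<-cmp x y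
... | tri< x<y _ _ = ⊥-elim (ℕ.0≢1+n (begin
  0                                          ≡⟨ multiplicity-below-head v hv x<y ⟨
  Vec.lookup (multiplicities (y ∷ v)) x      ≡⟨ cong (λ m → Vec.lookup m x) mu≡mv ⟨
  Vec.lookup (multiplicities (x ∷ u)) x      ≡⟨ lookup∘updateAt x (multiplicities u) ⟩
  suc (Vec.lookup (multiplicities u) x)      ∎))
  where open ≡-Reasoning
... | tri> _ _ y<x = ⊥-elim (ℕ.0≢1+n (begin
  0                                          ≡⟨ multiplicity-below-head u hu y<x ⟨
  Vec.lookup (multiplicities (x ∷ u)) y      ≡⟨ cong (λ m → Vec.lookup m y) mu≡mv ⟩
  Vec.lookup (multiplicities (y ∷ v)) y      ≡⟨ lookup∘updateAt y (multiplicities v) ⟩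
  suc (Vec.lookup (multiplicities v) y)      ∎))
  where open ≡-Reasoning
... | tri≈ _ refl _ = cong (x ∷_) (sorted-multiplicities-injective u v (increasing-tail x u hu) (increasing-tail x v hv)
  (updateAt-suc-injective x mu≡mv))

module _ {n} (σ : Permutation′ n) where

  private
    σ-injective : Injective _≡_ _≡_ (σ ⟨$⟩ʳ_)
    σ-injective {x} {y} σx≡σy = trans (sym (inverseˡ σ)) (trans (cong (σ ⟨$⟩ˡ_) σx≡σy) (inverseˡ σ))

  symPow-fixed⇔invariant : ∀ {k} (v : Vec (Fin n) k) → T (increasingᵇ v) →
    symPow k σ v ≡ v ⇔ (∀ x → Vec.lookup (multiplicities v) (σ ⟨$⟩ʳ x) ≡ Vec.lookup (multiplicities v) x)
  symPow-fixed⇔invariant {k} v v↑ = mk⇔ fixed⇒invariant invariant⇒fixed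
    where
    m : Vec ℕ n
    m = multiplicities v
    σv : Vec (Fin n) k
    σv = Vec.map (σ ⟨$⟩ʳ_) v
    fixed⇒invariant : sort σv ≡ v → ∀ x → Vec.lookup m (σ ⟨$⟩ʳ x) ≡ Vec.lookup m x
    fixed⇒invariant fixed x = begin
      Vec.lookup m (σ ⟨$⟩ʳ x)
        ≡⟨ cong (λ w → Vec.lookup (multiplicities w) (σ ⟨$⟩ʳ x)) fixed ⟨
      Vec.lookup (multiplicities (sort σv)) (σ ⟨$⟩ʳ x)
        ≡⟨ cong (λ m′ → Vec.lookup m′ (σ ⟨$⟩ʳ x)) (multiplicities-sort σv) ⟩
      Vec.lookup (multiplicities σv) (σ ⟨$⟩ʳ x)
        ≡⟨ lookup-multiplicities-map (σ ⟨$⟩ʳ_) σ-injective v x ⟩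
      Vec.lookup m x ∎
      where open ≡-Reasoning
    invariant⇒fixed : (∀ x → Vec.lookup m (σ ⟨$⟩ʳ x) ≡ Vec.lookup m x) → sort σv ≡ v
    invariant⇒fixed invariant = sorted-multiplicities-injective (sort σv) v (sort-increasing σv) v↑
      (trans (multiplicities-sort σv) (lookup-extensionality λ y → begin
        Vec.lookup (multiplicities σv) y
          ≡⟨ cong (Vec.lookup (multiplicities σv)) (inverseʳ σ) ⟨
        Vec.lookup (multiplicities σv) (σ ⟨$⟩ʳ (σ ⟨$⟩ˡ y))
          ≡⟨ lookup-multiplicities-map (σ ⟨$⟩ʳ_) σ-injective v (σ ⟨$⟩ˡ y) ⟩
        Vec.lookup m (σ ⟨$⟩ˡ y)
          ≡⟨ invariant (σ ⟨$⟩ˡ y) ⟨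
        Vec.lookup m (σ ⟨$⟩ʳ (σ ⟨$⟩ˡ y))
          ≡⟨ cong (Vec.lookup m) (inverseʳ σ) ⟩
        Vec.lookup m y ∎))
      where open ≡-Reasoning

Balanced : ∀ {r n} (a b : Fin r → Fin n) → Vec ℕ n → Set
Balanced a b m = ∀ i → Vec.lookup m (a i) ≡ Vec.lookup m (b i)

balanced? : ∀ {r n} (a b : Fin r → Fin n) → Decidable (Balanced a b)
balanced? a b m = Fin.all? (λ i → Vec.lookup m (a i) ℕ.≟ Vec.lookup m (b i))

balancedᵇ : ∀ {r n} (a b : Fin r → Fin n) → Vec ℕ n → Bool
balancedᵇ a b m = does (balanced? a b m)

module _ {n r} (σ : Permutation′ n) (a b : Fin r → Fin n)
  (σa≡b : ∀ i → σ ⟨$⟩ʳ a i ≡ b i) (σb≡a : ∀ i → σ ⟨$⟩ʳ b i ≡ a i)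
  (σ-fixes-rest : ∀ x → (∀ i → x ≢ a i × x ≢ b i) → σ ⟨$⟩ʳ x ≡ x) where

  invariant⇔balanced : (g : Fin n → A) → (∀ x → g (σ ⟨$⟩ʳ x) ≡ g x) ⇔ (∀ i → g (a i) ≡ g (b i))
  invariant⇔balanced g = mk⇔ (λ invariant i → trans (sym (invariant (a i))) (cong g (σa≡b i))) balanced⇒invariant
    where
    balanced⇒invariant : (∀ i → g (a i) ≡ g (b i)) → ∀ x → g (σ ⟨$⟩ʳ x) ≡ g x
    balanced⇒invariant balanced x with Fin.any? (λ i → x Fin.≟ a i) | Fin.any? (λ i → x Fin.≟ b i)
    ... | yes (i , refl) | _              = trans (cong g (σa≡b i)) (sym (balanced i))
    ... | no _           | yes (i , refl) = trans (cong g (σb≡a i)) (balanced i)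
    ... | no x∉a         | no x∉b         =
      cong g (σ-fixes-rest x (λ i → (λ x≡ai → x∉a (i , x≡ai)) , (λ x≡bi → x∉b (i , x≡bi))))

  FixSymPow≡countBalanced : ∀ k → FixSymPow k σ ≡ countCompositions n k (balancedᵇ a b)
  FixSymPow≡countBalanced k = begin
    FixSymPow k σ
      ≡⟨ length-filter fixed? (C n k) ⟩
    count (λ v → does (fixed? v)) (C n k)
      ≡⟨ count-filter (λ v → T? (increasingᵇ v)) (λ v → does (fixed? v)) (allTuples n k) ⟩
    countTuples n k (λ v → increasingᵇ v ∧ does (fixed? v))
      ≡⟨ countTuples-cong n k (λ v → ∧-congˡ-T (λ v↑ →
           does-⇔ (⇔.trans (symPow-fixed⇔invariant σ v v↑) (invariant⇔balanced (Vec.lookup (multiplicities v))))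
                  (fixed? v) (balanced? a b (multiplicities v)))) ⟩
    countTuples n k (λ v → increasingᵇ v ∧ balancedᵇ a b (multiplicities v))
      ≡⟨ countSorted≡countCompositions n k (balancedᵇ a b) ⟩
    countCompositions n k (balancedᵇ a b) ∎
    where
    open ≡-Reasoning
    fixed? : (v : Vec (Fin n) k) → Dec (symPow k σ v ≡ v)
    fixed? v = ≡-dec Fin._≟_ (symPow k σ v) v

multichoose : ℕ → ℕ → ℕ
multichoose f m = countCompositions f m (λ _ → true)

closedForm : ℕ → ℕ → ℕ → ℕ
closedForm r f k = Σ≤ (k / 2) (λ ℓ → multichoose r ℓ * multichoose f (k ∸ 2 * ℓ))

sumStride2 : (ℕ → ℕ) → ℕ → ℕ
sumStride2 g zero          = g 0
sumStride2 g (suc zero)    = g 1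
sumStride2 g (suc (suc k)) = g (suc (suc k)) + sumStride2 g k

Σ≤-head : ∀ k (g : ℕ → ℕ) → (∀ j → g (suc j) ≡ 0) → Σ≤ k g ≡ g 0
Σ≤-head zero    g g≡0 = refl
Σ≤-head (suc k) g g≡0 =
  trans (cong (λ s → g 0 + s) (trans (Σ≤-cong k (λ j _ → g≡0 j)) (Σ≤-zero k))) (ℕ.+-identityʳ (g 0))

Σ≤-[j≤k∸j]≡sumStride2 : ∀ (g : ℕ → ℕ) k →
  Σ≤ k (λ j → if j ≤ᵇ k ∸ j then g (k ∸ j ∸ j) else 0) ≡ sumStride2 g k
Σ≤-[j≤k∸j]≡sumStride2 g zero          = refl
Σ≤-[j≤k∸j]≡sumStride2 g (suc zero)    = ℕ.+-identityʳ (g 1)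
Σ≤-[j≤k∸j]≡sumStride2 g (suc (suc k)) = cong (λ s → g (suc (suc k)) + s) (begin
  Σ≤ (suc k) (λ j → G (suc j))                                    ≡⟨ Σ≤-snoc k (λ j → G (suc j)) ⟩
  Σ≤ k (λ j → G (suc j)) + G (suc (suc k))                        ≡⟨ cong₂ _+_ (Σ≤-cong k G-suc) G-last ⟩
  Σ≤ k (λ j → if j ≤ᵇ k ∸ j then g (k ∸ j ∸ j) else 0) + 0       ≡⟨ ℕ.+-identityʳ _ ⟩
  Σ≤ k (λ j → if j ≤ᵇ k ∸ j then g (k ∸ j ∸ j) else 0)           ≡⟨ Σ≤-[j≤k∸j]≡sumStride2 g k ⟩
  sumStride2 g k                                                  ∎)
  where
  open ≡-Reasoning
  G : ℕ → ℕ
  G j = if j ≤ᵇ suc (suc k) ∸ j then g (suc (suc k) ∸ j ∸ j) else 0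
  G-suc : ∀ j → j ≤ k → G (suc j) ≡ (if j ≤ᵇ k ∸ j then g (k ∸ j ∸ j) else 0)
  G-suc j j≤k = trans (cong (λ l → if suc j ≤ᵇ l then g (l ∸ suc j) else 0) (ℕ.+-∸-assoc 1 j≤k))
                      (cong (λ b → if b then g (k ∸ j ∸ j) else 0) (suc-≤ᵇ-suc j (k ∸ j)))
  G-last : G (suc (suc k)) ≡ 0
  G-last = cong (λ l → if suc (suc k) ≤ᵇ l then g (l ∸ suc (suc k)) else 0) (ℕ.n∸n≡0 k)

closedForm-zero : ∀ f k → closedForm 0 f k ≡ multichoose f k
closedForm-zero f k = trans (Σ≤-head (k / 2) _ (λ _ → refl)) (ℕ.+-identityʳ (multichoose f k))

closedForm-unfold : ∀ r f k → closedForm r f (suc (suc k)) ≡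
  multichoose r 0 * multichoose f (suc (suc k)) +
  Σ≤ (k / 2) (λ ℓ → multichoose r (suc ℓ) * multichoose f (k ∸ 2 * ℓ))
closedForm-unfold r f k =
  trans (cong (λ u → Σ≤ u (λ ℓ → multichoose r ℓ * multichoose f (suc (suc k) ∸ 2 * ℓ)))
              (m/n≡1+[m∸n]/n {suc (suc k)} (s≤s (s≤s z≤n))))
        (cong (λ s → multichoose r 0 * multichoose f (suc (suc k)) + s) (Σ≤-cong (k / 2) (λ ℓ _ →
          cong (λ l → multichoose r (suc ℓ) * multichoose f (suc k ∸ l)) (ℕ.+-suc ℓ (ℓ + 0)))))

closedForm-pascal : ∀ r f k → closedForm (suc r) f (suc (suc k)) ≡ closedForm r f (suc (suc k)) + closedForm (suc r) f k
closedForm-pascal r f k = begin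
  closedForm (suc r) f (suc (suc k))
    ≡⟨ closedForm-unfold (suc r) f k ⟩
  head + Σ≤ (k / 2) (λ ℓ → (multichoose r (suc ℓ) + multichoose (suc r) ℓ) * multichoose f (k ∸ 2 * ℓ))
    ≡⟨ cong (λ s → head + s) (trans
         (Σ≤-cong (k / 2) (λ ℓ _ → ℕ.*-distribʳ-+ (multichoose f (k ∸ 2 * ℓ)) (multichoose r (suc ℓ)) _))
         (Σ≤-+ (k / 2) _ _)) ⟩
  head + (Σ≤ (k / 2) (λ ℓ → multichoose r (suc ℓ) * multichoose f (k ∸ 2 * ℓ)) + closedForm (suc r) f k)
    ≡⟨ ℕ.+-assoc head _ _ ⟨
  head + Σ≤ (k / 2) (λ ℓ → multichoose r (suc ℓ) * multichoose f (k ∸ 2 * ℓ)) + closedForm (suc r) f k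
    ≡⟨ cong (λ s → s + closedForm (suc r) f k) (closedForm-unfold r f k) ⟨
  closedForm r f (suc (suc k)) + closedForm (suc r) f k ∎
  where
  open ≡-Reasoning
  head : ℕ
  head = multichoose r 0 * multichoose f (suc (suc k))

closedForm-suc : ∀ r f k → closedForm (suc r) f k ≡ sumStride2 (closedForm r f) k
closedForm-suc r f zero          = refl
closedForm-suc r f (suc zero)    = refl
closedForm-suc r f (suc (suc k)) =
  trans (closedForm-pascal r f k) (cong (λ s → closedForm r f (suc (suc k)) + s) (closedForm-suc r f k))

lookup-insertAt-≢ : ∀ {n} (m : Vec A n) {i j : Fin (suc n)} x (i≢j : i ≢ j) →
  Vec.lookup (Vec.insertAt m i x) j ≡ Vec.lookup m (Fin.punchOut i≢j)
lookup-insertAt-≢ m {i} x i≢j =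
  trans (cong (Vec.lookup (Vec.insertAt m i x)) (sym (Fin.punchIn-punchOut i≢j))) (insertAt-punchIn m i x (Fin.punchOut i≢j))

module PairRemoval {r n} (a b : Fin (suc r) → Fin (suc (suc n))) (ab-injective : Injective _≡_ _≡_ [ a , b ]) where

  p q : Fin (suc (suc n))
  p = a Fin.zero
  q = b Fin.zero

  p≢q : p ≢ q
  p≢q p≡q with ab-injective {inj₁ Fin.zero} {inj₂ Fin.zero} p≡q
  ... | ()

  shift : Fin r ⊎ Fin r → Fin (suc r) ⊎ Fin (suc r)
  shift = Sum.map Fin.suc Fin.suc

  shift-injective : Injective _≡_ _≡_ shift
  shift-injective {inj₁ _} {inj₁ _} e = cong inj₁ (Fin.suc-injective (inj₁-injective e))
  shift-injective {inj₂ _} {inj₂ _} e = cong inj₂ (Fin.suc-injective (inj₂-injective e))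

  rest : Fin r ⊎ Fin r → Fin (suc (suc n))
  rest t = [ a , b ] (shift t)

  p≢rest : ∀ t → p ≢ rest t
  p≢rest (inj₁ i) e with ab-injective {inj₁ Fin.zero} {inj₁ (Fin.suc i)} e
  ... | ()
  p≢rest (inj₂ i) e with ab-injective {inj₁ Fin.zero} {inj₂ (Fin.suc i)} e
  ... | ()

  q≢rest : ∀ t → q ≢ rest t
  q≢rest (inj₁ i) e with ab-injective {inj₂ Fin.zero} {inj₁ (Fin.suc i)} e
  ... | ()
  q≢rest (inj₂ i) e with ab-injective {inj₂ Fin.zero} {inj₂ (Fin.suc i)} e
  ... | ()

  q′ : Fin (suc n)
  q′ = Fin.punchOut p≢q

  q′≢punchOut-rest : ∀ t → q′ ≢ Fin.punchOut (p≢rest t)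
  q′≢punchOut-rest t = q≢rest t ∘ Fin.punchOut-injective p≢q (p≢rest t)

  remove : Fin r ⊎ Fin r → Fin n
  remove t = Fin.punchOut (q′≢punchOut-rest t)

  remove-injective : Injective _≡_ _≡_ remove
  remove-injective {t} {u} e = shift-injective (ab-injective (Fin.punchOut-injective (p≢rest t) (p≢rest u)
    (Fin.punchOut-injective (q′≢punchOut-rest t) (q′≢punchOut-rest u) e)))

  a′ b′ : Fin r → Fin n
  a′ = remove ∘ inj₁
  b′ = remove ∘ inj₂

  a′b′-injective : Injective _≡_ _≡_ [ a′ , b′ ]
  a′b′-injective {inj₁ _} {inj₁ _} = remove-injective
  a′b′-injective {inj₁ _} {inj₂ _} = remove-injective
  a′b′-injective {inj₂ _} {inj₁ _} = remove-injective
  a′b′-injective {inj₂ _} {inj₂ _} = remove-injective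

  module _ (m : Vec ℕ n) (j j′ : ℕ) where

    M : Vec ℕ (suc (suc n))
    M = Vec.insertAt (Vec.insertAt m q′ j′) p j

    lookup-p : Vec.lookup M p ≡ j
    lookup-p = insertAt-lookup _ p j

    lookup-q : Vec.lookup M q ≡ j′
    lookup-q = trans (lookup-insertAt-≢ _ j p≢q) (insertAt-lookup m q′ j′)

    lookup-rest : ∀ t → Vec.lookup M (rest t) ≡ Vec.lookup m (remove t)
    lookup-rest t = trans (lookup-insertAt-≢ _ j (p≢rest t)) (lookup-insertAt-≢ m j′ (q′≢punchOut-rest t))

    balanced-insertAt⇔ : Balanced a b M ⇔ (j ≡ j′ × Balanced a′ b′ m)
    balanced-insertAt⇔ = mk⇔ to from
      where
      to : Balanced a b M → j ≡ j′ × Balanced a′ b′ m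
      to h = trans (sym lookup-p) (trans (h Fin.zero) lookup-q)
           , λ i → trans (sym (lookup-rest (inj₁ i))) (trans (h (Fin.suc i)) (lookup-rest (inj₂ i)))
      from : j ≡ j′ × Balanced a′ b′ m → Balanced a b M
      from (j≡j′ , h) Fin.zero    = trans lookup-p (trans j≡j′ (sym lookup-q))
      from (j≡j′ , h) (Fin.suc i) = trans (lookup-rest (inj₁ i)) (trans (h i) (sym (lookup-rest (inj₂ i))))

    balancedᵇ-insertAt : balancedᵇ a b M ≡ does (j ℕ.≟ j′) ∧ balancedᵇ a′ b′ m
    balancedᵇ-insertAt = does-⇔ balanced-insertAt⇔ (balanced? a b M) ((j ℕ.≟ j′) ×-dec balanced? a′ b′ m)

  countBalanced-removePair : ∀ k → countCompositions (suc (suc n)) k (balancedᵇ a b) ≡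
    Σ≤ k (λ j → if j ≤ᵇ k ∸ j then countCompositions n (k ∸ j ∸ j) (balancedᵇ a′ b′) else 0)
  countBalanced-removePair k = begin
    countCompositions (suc (suc n)) k (balancedᵇ a b)
      ≡⟨ countCompositions-insertAt (suc n) k (balancedᵇ a b) p ⟩
    Σ≤ k (λ j → countCompositions (suc n) (k ∸ j) (λ m → balancedᵇ a b (Vec.insertAt m p j)))
      ≡⟨ Σ≤-cong k (λ j _ → countCompositions-insertAt n (k ∸ j) (λ m → balancedᵇ a b (Vec.insertAt m p j)) q′) ⟩
    Σ≤ k (λ j → Σ≤ (k ∸ j) (λ j′ → countCompositions n (k ∸ j ∸ j′) (λ m → balancedᵇ a b (M m j j′))))
      ≡⟨ Σ≤-cong k (λ j _ → Σ≤-cong (k ∸ j) (λ j′ _ →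
           trans (countCompositions-cong n (k ∸ j ∸ j′) (λ m → balancedᵇ-insertAt m j j′))
                 (countCompositions-∧ n (k ∸ j ∸ j′) (does (j ℕ.≟ j′)) (balancedᵇ a′ b′)))) ⟩
    Σ≤ k (λ j → Σ≤ (k ∸ j) (λ j′ → if does (j ℕ.≟ j′) then count′ (k ∸ j ∸ j′) else 0))
      ≡⟨ Σ≤-cong k (λ j _ → Σ≤-select (k ∸ j) j (λ j′ → count′ (k ∸ j ∸ j′))) ⟩
    Σ≤ k (λ j → if j ≤ᵇ k ∸ j then count′ (k ∸ j ∸ j) else 0) ∎
    where
    open ≡-Reasoning
    count′ : ℕ → ℕ
    count′ l = countCompositions n l (balancedᵇ a′ b′)

countBalanced≡closedForm : ∀ r n (a b : Fin r → Fin n) → Injective _≡_ _≡_ [ a , b ] → ∀ k →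
  countCompositions n k (balancedᵇ a b) ≡ closedForm r (n ∸ 2 * r) k
countBalanced≡closedForm zero    n             a b _ k = sym (closedForm-zero n k)
countBalanced≡closedForm (suc r) zero          a b _ k with a Fin.zero
... | ()
countBalanced≡closedForm (suc r) (suc zero)    a b ab-injective k with a Fin.zero in a₀ | b Fin.zero in b₀
... | Fin.zero | Fin.zero with ab-injective {inj₁ Fin.zero} {inj₂ Fin.zero} (trans a₀ (sym b₀))
... | ()
countBalanced≡closedForm (suc r) (suc (suc n)) a b ab-injective k = begin
  countCompositions (suc (suc n)) k (balancedᵇ a b)
    ≡⟨ countBalanced-removePair k ⟩
  Σ≤ k (λ j → if j ≤ᵇ k ∸ j then countCompositions n (k ∸ j ∸ j) (balancedᵇ a′ b′) else 0)
    ≡⟨ Σ≤-cong k (λ j _ → cong (λ c → if j ≤ᵇ k ∸ j then c else 0)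
                             (countBalanced≡closedForm r n a′ b′ a′b′-injective (k ∸ j ∸ j))) ⟩
  Σ≤ k (λ j → if j ≤ᵇ k ∸ j then closedForm r (n ∸ 2 * r) (k ∸ j ∸ j) else 0)
    ≡⟨ Σ≤-[j≤k∸j]≡sumStride2 (closedForm r (n ∸ 2 * r)) k ⟩
  sumStride2 (closedForm r (n ∸ 2 * r)) k
    ≡⟨ closedForm-suc r (n ∸ 2 * r) k ⟨
  closedForm (suc r) (n ∸ 2 * r) k
    ≡⟨ cong (λ l → closedForm (suc r) (suc n ∸ l) k) (ℕ.+-suc r (r + 0)) ⟨
  closedForm (suc r) (suc (suc n) ∸ 2 * suc r) k ∎
  where
  open ≡-Reasoning
  open PairRemoval a b ab-injective

multichoose-one : ∀ m → multichoose 1 m ≡ 1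
multichoose-one zero    = refl
multichoose-one (suc m) = multichoose-one m

multichoose-suc≡C : ∀ f m → multichoose (suc f) m ≡ (m + f) choose m
multichoose-suc≡C f       zero    = countCompositions-zero (suc f) (λ _ → true)
multichoose-suc≡C zero    (suc m) =
  trans (multichoose-one (suc m)) (sym (trans (cong (_choose suc m) (ℕ.+-identityʳ (suc m))) (nCn≡1 (suc m))))
multichoose-suc≡C (suc f) (suc m) = begin
  multichoose (suc f) (suc m) + multichoose (suc (suc f)) m
    ≡⟨ cong₂ _+_ (multichoose-suc≡C f (suc m)) (multichoose-suc≡C (suc f) m) ⟩
  (suc m + f) choose suc m + (m + suc f) choose m
    ≡⟨ cong (λ l → l choose suc m + (m + suc f) choose m) (ℕ.+-suc m f) ⟨
  (m + suc f) choose suc m + (m + suc f) choose m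
    ≡⟨ ℕ.+-comm ((m + suc f) choose suc m) _ ⟩
  (m + suc f) choose m + (m + suc f) choose suc m
    ≡⟨ nCk+nC[k+1]≡[n+1]C[k+1] (m + suc f) m ⟩
  suc (m + suc f) choose suc m ∎
  where open ≡-Reasoning

multichoose≡C : ∀ f m → multichoose f m ≡ (m + f ∸ 1) choose m
multichoose≡C zero    zero    = refl
multichoose≡C zero    (suc m) = sym (k>n⇒nCk≡0 (s≤s (ℕ.≤-reflexive (ℕ.+-identityʳ m))))
multichoose≡C (suc f) m       = trans (multichoose-suc≡C f m) (cong (λ l → (l ∸ 1) choose m) (sym (ℕ.+-suc m f)))

+m-+n≡+[m∸n] : ∀ {m n} → n ≤ m → + m - + n ≡ + (m ∸ n)
+m-+n≡+[m∸n] {m} {n} n≤m = trans (ℤ.[+m]-[+n]≡m⊖n m n) (ℤ.⊖-≥ n≤m)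

fallingℤ≡P′ : ∀ N m → m ≤ N → fallingℤ (+ N) m ≡ + (N P′ m)
fallingℤ≡P′ N zero    _   = refl
fallingℤ≡P′ N (suc m) m<N = begin
  fallingℤ (+ N) m ℤ.* (+ N - + m)  ≡⟨ cong₂ ℤ._*_ (fallingℤ≡P′ N m m≤N) (+m-+n≡+[m∸n] m≤N) ⟩
  + (N P′ m) ℤ.* + (N ∸ m)          ≡⟨ ℤ.pos-* (N P′ m) (N ∸ m) ⟨
  + ((N P′ m) * (N ∸ m))            ≡⟨ cong +_ (ℕ.*-comm (N P′ m) (N ∸ m)) ⟩
  + ((N ∸ m) * (N P′ m))            ∎
  where
  open ≡-Reasoning
  m≤N : m ≤ N
  m≤N = ℕ.<⇒≤ m<N

fallingℤ-vanishes : ∀ N m → N < m → fallingℤ (+ N) m ≡ + 0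
fallingℤ-vanishes N (suc m) (s≤s N≤m) with ℕ.m≤n⇒m<n∨m≡n N≤m
... | inj₁ N<m  = trans (cong (ℤ._* (+ N - + m)) (fallingℤ-vanishes N m N<m)) (ℤ.*-zeroˡ (+ N - + m))
... | inj₂ refl = trans (cong (fallingℤ (+ N) N ℤ.*_) (ℤ.+-inverseʳ (+ N))) (ℤ.*-zeroʳ (fallingℤ (+ N) N))

binomℤ≡C : ∀ N m → binomℤ (+ N) m ≡ + (N choose m)
binomℤ≡C N m with m ℕ.≤? N
... | yes m≤N = begin
  (fallingℤ (+ N) m ℤ./ℕ m !) {{m ℕ.!≢0}}
    ≡⟨ cong (λ z → (z ℤ./ℕ m !) {{m ℕ.!≢0}}) (fallingℤ≡P′ N m m≤N) ⟩
  + (((N P′ m) / m !) {{m ℕ.!≢0}})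
    ≡⟨ cong (λ x → + ((x / m !) {{m ℕ.!≢0}})) nPm≡nP′m ⟨
  + (((N P m) / m !) {{m ℕ.!≢0}})
    ≡⟨ cong +_ (nCk≡nPk/k! m≤N) ⟨
  + (N choose m) ∎
  where
  open ≡-Reasoning
  nPm≡nP′m : N P m ≡ N P′ m
  nPm≡nP′m = cong (λ b → if b then N P′ m else 0) (Equivalence.to T-≡ (ℕ.≤⇒≤ᵇ m≤N))
... | no  m≰N = begin
  (fallingℤ (+ N) m ℤ./ℕ m !) {{m ℕ.!≢0}}
    ≡⟨ cong (λ z → (z ℤ./ℕ m !) {{m ℕ.!≢0}}) (fallingℤ-vanishes N m (ℕ.≰⇒> m≰N)) ⟩
  + ((0 / m !) {{m ℕ.!≢0}})
    ≡⟨ cong +_ (0/n≡0 (m !) {{m ℕ.!≢0}}) ⟩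
  + 0
    ≡⟨ cong +_ (k>n⇒nCk≡0 (ℕ.≰⇒> m≰N)) ⟨
  + (N choose m) ∎
  where open ≡-Reasoning

binomℤ≡multichoose : ∀ f m → binomℤ (+ m ℤ.+ + f - + 1) m ≡ + multichoose f m
binomℤ≡multichoose zero    zero    = refl  -- binomℤ (-1) 0 = 1: the only negative top entry (k = 2ℓ, n = 2r)
binomℤ≡multichoose (suc f) zero    = trans (binomℤ≡C f 0) (cong +_ (sym (multichoose≡C (suc f) 0)))
binomℤ≡multichoose f       (suc m) = trans (binomℤ≡C (m + f) (suc m)) (cong +_ (sym (multichoose≡C f (suc m))))

[+k-+x]++n-+y≡+[k∸x]++[n∸y] : ∀ {k n x y} → x ≤ k → y ≤ n →
  + k - + x ℤ.+ + n - + y ≡ + (k ∸ x) ℤ.+ + (n ∸ y)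
[+k-+x]++n-+y≡+[k∸x]++[n∸y] {k} {n} {x} {y} x≤k y≤n = begin
  + k - + x ℤ.+ + n - + y      ≡⟨ cong (λ z → z ℤ.+ + n - + y) (+m-+n≡+[m∸n] x≤k) ⟩
  + (k ∸ x + n) - + y          ≡⟨ +m-+n≡+[m∸n] (ℕ.≤-trans y≤n (ℕ.m≤n+m n (k ∸ x))) ⟩
  + (k ∸ x + n ∸ y)            ≡⟨ cong +_ (ℕ.+-∸-assoc (k ∸ x) y≤n) ⟩
  + (k ∸ x) ℤ.+ + (n ∸ y)      ∎
  where open ≡-Reasoning

2*[m/2]≤m : ∀ {x m} → x ≤ m / 2 → 2 * x ≤ m
2*[m/2]≤m {x} {m} x≤m/2 = begin
  2 * x        ≤⟨ ℕ.*-monoʳ-≤ 2 x≤m/2 ⟩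
  2 * (m / 2)  ≡⟨ ℕ.*-comm 2 (m / 2) ⟩
  m / 2 * 2    ≤⟨ m/n*n≤m m 2 ⟩
  m            ∎
  where open ℕ.≤-Reasoning

binomialProduct≡multichooseProduct : ∀ n k r ℓ → 2 * ℓ ≤ k → 2 * r ≤ n →
  binomℤ (+ ℓ ℤ.+ + r - + 1) ℓ ℤ.* binomℤ (+ k - + (2 * ℓ) ℤ.+ + n - + (2 * r) - + 1) (k ∸ 2 * ℓ) ≡
  + (multichoose r ℓ * multichoose (n ∸ 2 * r) (k ∸ 2 * ℓ))
binomialProduct≡multichooseProduct n k r ℓ 2ℓ≤k 2r≤n = begin
  binomℤ (+ ℓ ℤ.+ + r - + 1) ℓ ℤ.* binomℤ (+ k - + (2 * ℓ) ℤ.+ + n - + (2 * r) - + 1) (k ∸ 2 * ℓ)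
    ≡⟨ cong (λ t → binomℤ (+ ℓ ℤ.+ + r - + 1) ℓ ℤ.* binomℤ (t - + 1) (k ∸ 2 * ℓ))
            ([+k-+x]++n-+y≡+[k∸x]++[n∸y] 2ℓ≤k 2r≤n) ⟩
  binomℤ (+ ℓ ℤ.+ + r - + 1) ℓ ℤ.* binomℤ (+ (k ∸ 2 * ℓ) ℤ.+ + (n ∸ 2 * r) - + 1) (k ∸ 2 * ℓ)
    ≡⟨ cong₂ ℤ._*_ (binomℤ≡multichoose r ℓ) (binomℤ≡multichoose (n ∸ 2 * r) (k ∸ 2 * ℓ)) ⟩
  + multichoose r ℓ ℤ.* + multichoose (n ∸ 2 * r) (k ∸ 2 * ℓ)
    ≡⟨ ℤ.pos-* (multichoose r ℓ) (multichoose (n ∸ 2 * r) (k ∸ 2 * ℓ)) ⟨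
  + (multichoose r ℓ * multichoose (n ∸ 2 * r) (k ∸ 2 * ℓ)) ∎
  where open ≡-Reasoning

sumTo≡Σ≤ : ∀ m (g : ℕ → ℤ) (h : ℕ → ℕ) → (∀ ℓ → ℓ ≤ m → g ℓ ≡ + h ℓ) → sumTo m g ≡ + Σ≤ m h
sumTo≡Σ≤ zero    g h g≗h = g≗h 0 z≤n
sumTo≡Σ≤ (suc m) g h g≗h = begin
  sumTo m g ℤ.+ g (suc m)
    ≡⟨ cong₂ ℤ._+_ (sumTo≡Σ≤ m g h (λ ℓ ℓ≤m → g≗h ℓ (ℕ.m≤n⇒m≤1+n ℓ≤m))) (g≗h (suc m) ℕ.≤-refl) ⟩
  + Σ≤ m h ℤ.+ + h (suc m)
    ≡⟨ cong +_ (Σ≤-snoc m h) ⟨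
  + Σ≤ (suc m) h ∎
  where open ≡-Reasoning

theorem3p1 : (n k r : ℕ) → 1 ≤ n → 1 ≤ k → 1 ≤ r → r ≤ n / 2 →
    (σ : Permutation′ n) → (a b : Fin r → Fin n) →
    Injective _≡_ _≡_ [ a , b ] →
    (∀ i → σ ⟨$⟩ʳ a i ≡ b i) → (∀ i → σ ⟨$⟩ʳ b i ≡ a i) →
    (∀ x → (∀ i → x ≢ a i × x ≢ b i) → σ ⟨$⟩ʳ x ≡ x) →
    + FixSymPow k σ ≡ sumTo (k / 2) (λ ℓ →
      binomℤ (+ ℓ ℤ.+ + r - + 1) ℓ
        ℤ.* binomℤ (+ k - + (2 * ℓ) ℤ.+ + n - + (2 * r) - + 1) (k ∸ 2 * ℓ))
theorem3p1 n k r _ _ _ r≤n/2 σ a b ab-injective σa≡b σb≡a σ-fixes-rest = begin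
  + FixSymPow k σ
    ≡⟨ cong +_ (FixSymPow≡countBalanced σ a b σa≡b σb≡a σ-fixes-rest k) ⟩
  + countCompositions n k (balancedᵇ a b)
    ≡⟨ cong +_ (countBalanced≡closedForm r n a b ab-injective k) ⟩
  + closedForm r (n ∸ 2 * r) k
    ≡⟨ sumTo≡Σ≤ (k / 2) _ _ (λ ℓ ℓ≤k/2 →
         binomialProduct≡multichooseProduct n k r ℓ (2*[m/2]≤m ℓ≤k/2) (2*[m/2]≤m r≤n/2)) ⟨
  sumTo (k / 2) (λ ℓ → binomℤ (+ ℓ ℤ.+ + r - + 1) ℓ
                         ℤ.* binomℤ (+ k - + (2 * ℓ) ℤ.+ + n - + (2 * r) - + 1) (k ∸ 2 * ℓ)) ∎
  where open ≡-Reasoning
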